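{- Let $D$ be a deck of order $n$, with $c$ cards and length $\ell$. Then $$\frac{cn}{\ell}\leq\frac{c+n-1}{n}.$$
   Context: A deck consists of a finite set $S$ of symbols together with a finite collection $D$ of distinct cards, each card being a subset of $S$, satisfying: (D1) any two distinct cards have exactly one symbol in common; (D2) every symbol of $S$ lies on at least two cards; (D3) every card contains at least two symbols; (D4) all cards have the same cardinality $n$ (the order); (D5) $S$ is nonempty. $\ell=|S|$ is the length and $c=|D|$ the number of cards. -}

module Defs where

open import Data.Nat using (ℕ; _≥_)
open import Data.Fin using (Fin)
open import Data.Fin.Subset using (Subset; _∈_; _∩_; ∣_∣)
open import Data.Product using (_×_; Σ; ∃; ∃-syntax; _,_)
open import Relation.Binary.PropositionalEquality using (_≡_; _≢_)
open import Function.Definitions using (Injective)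

-- A deck with ℓ symbols (the set S = Fin ℓ), c cards (indexed by Fin c),
-- each card a subset of the symbols.
record IsDeck (ℓ c n : ℕ) (card : Fin c → Subset ℓ) : Set where
  field
    distinct : Injective _≡_ _≡_ card
    D1 : ∀ i j → i ≢ j → ∣ card i ∩ card j ∣ ≡ 1
    D2 : ∀ (s : Fin ℓ) → ∃[ i ] ∃[ j ] (i ≢ j × s ∈ card i × s ∈ card j)
    D3 : ∀ i → ∣ card i ∣ ≥ 2
    D4 : ∀ i → ∣ card i ∣ ≡ n
    D5 : ℓ ≥ 1

-- Let r s be the number of cards containing the symbol s. Counting incidences gives
-- ∑ r s = c n, and counting incident pairs of cards gives ∑ r s² = ∑ᵢ ∑ⱼ ∣Cᵢ ∩ Cⱼ∣,
-- which by (D1) equals c (n + c − 1). Cauchy–Schwarz, (∑ r s)² ≤ ℓ ∑ r s², then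
-- reads c² n² ≤ ℓ c (n + c − 1).
module Submission where

open import Defs
open import Data.Bool using (Bool; true; false; _∧_)
open import Data.Fin using (Fin; zero; suc; punchIn)
open import Data.Fin.Properties using (punchInᵢ≢i)
open import Data.Fin.Subset using (Subset; _∩_; ∣_∣)
open import Data.Fin.Subset.Properties using (∩-idem)
open import Data.Nat using (ℕ; zero; suc; _+_; _*_; _∸_; _≤_; z≤n)
open import Data.Nat.Properties
open import Data.Nat.Tactic.RingSolver using (solve-∀)
open import Data.Product using (_,_)
open import Data.Sum using (inj₁; inj₂)
open import Data.Vec using ([]; _∷_; lookup)
open import Data.Vec.Properties using (lookup-zipWith)
open import Algebra.Properties.Semiring.Sum +-*-semiring
  using (sum; sum-syntax; sum-cong-≗; sum-remove; ∑-comm; ∑-distrib-+; *-distribˡ-sum; *-distribʳ-sum)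
open import Relation.Binary.PropositionalEquality

sum-const : ∀ k a → ∑[ _ < k ] a ≡ k * a
sum-const zero    a = refl
sum-const (suc k) a = cong (a +_) (sum-const k a)

sum-mono-≤ : ∀ {k} {f g : Fin k → ℕ} → (∀ s → f s ≤ g s) → sum f ≤ sum g
sum-mono-≤ {zero}  f≤g = z≤n
sum-mono-≤ {suc k} f≤g = +-mono-≤ (f≤g zero) (sum-mono-≤ (λ s → f≤g (suc s)))

sum*sum≡∑∑ : ∀ {k m} (f : Fin k → ℕ) (g : Fin m → ℕ) →
             sum f * sum g ≡ ∑[ s < k ] ∑[ t < m ] (f s * g t)
sum*sum≡∑∑ f g = trans (*-distribʳ-sum (sum g) f) (sum-cong-≗ (λ s → *-distribˡ-sum (f s) g))

sum-ones-except : ∀ {k} (f : Fin (suc k) → ℕ) i → (∀ j → j ≢ i → f j ≡ 1) → sum f ≡ f i + k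
sum-ones-except {k} f i off = begin
  sum f                            ≡⟨ sum-remove f ⟩
  f i + ∑[ j < k ] f (punchIn i j) ≡⟨ cong (f i +_) (sum-cong-≗ (λ j → off _ (punchInᵢ≢i i j))) ⟩
  f i + ∑[ _ < k ] 1               ≡⟨ cong (f i +_) (trans (sum-const k 1) (*-identityʳ k)) ⟩
  f i + k                          ∎
  where open ≡-Reasoning

2*[m*n]≤m*m+n*n-ordered : ∀ {m n} → m ≤ n → 2 * (m * n) ≤ m * m + n * n
2*[m*n]≤m*m+n*n-ordered {m} m≤n with d , refl ← m≤n⇒∃[o]m+o≡n m≤n =
  subst (2 * (m * (m + d)) ≤_) (gap m d) (m≤m+n _ (d * d))
  where
  gap : ∀ m d → 2 * (m * (m + d)) + d * d ≡ m * m + (m + d) * (m + d)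
  gap = solve-∀

2*[m*n]≤m*m+n*n : ∀ m n → 2 * (m * n) ≤ m * m + n * n
2*[m*n]≤m*m+n*n m n with ≤-total m n
... | inj₁ m≤n = 2*[m*n]≤m*m+n*n-ordered m≤n
... | inj₂ n≤m = subst₂ _≤_ (cong (2 *_) (*-comm n m)) (+-comm (n * n) (m * m))
                         (2*[m*n]≤m*m+n*n-ordered n≤m)

cauchy-schwarz : ∀ {k} (r : Fin k → ℕ) → sum r * sum r ≤ k * ∑[ s < k ] (r s * r s)
cauchy-schwarz {k} r = *-cancelˡ-≤ 2 (begin
  2 * (sum r * sum r)                              ≡⟨ cong (2 *_) (sum*sum≡∑∑ r r) ⟩
  2 * ∑[ s < k ] ∑[ t < k ] (r s * r t)            ≡⟨ *-distribˡ-sum 2 (λ s → ∑[ t < k ] (r s * r t)) ⟩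
  ∑[ s < k ] (2 * ∑[ t < k ] (r s * r t))          ≡⟨ sum-cong-≗ (λ s → *-distribˡ-sum 2 (λ t → r s * r t)) ⟩
  ∑[ s < k ] ∑[ t < k ] (2 * (r s * r t))          ≤⟨ sum-mono-≤ (λ s → sum-mono-≤ (λ t → 2*[m*n]≤m*m+n*n (r s) (r t))) ⟩
  ∑[ s < k ] ∑[ t < k ] (r s * r s + r t * r t)    ≡⟨ sum-cong-≗ (λ s → ∑-distrib-+ (λ _ → r s * r s) (λ t → r t * r t)) ⟩
  ∑[ s < k ] (∑[ _ < k ] (r s * r s) + Q)          ≡⟨ ∑-distrib-+ (λ s → ∑[ _ < k ] (r s * r s)) (λ _ → Q) ⟩
  ∑[ s < k ] ∑[ _ < k ] (r s * r s) + ∑[ _ < k ] Q ≡⟨ cong₂ _+_ ∑∑rₛ²≡k*Q (sum-const k Q) ⟩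
  k * Q + k * Q                                    ≡⟨ cong (k * Q +_) (+-identityʳ (k * Q)) ⟨
  2 * (k * Q)                                      ∎)
  where
  open ≤-Reasoning
  Q : ℕ
  Q = ∑[ s < k ] (r s * r s)
  ∑∑rₛ²≡k*Q : ∑[ s < k ] ∑[ _ < k ] (r s * r s) ≡ k * Q
  ∑∑rₛ²≡k*Q = trans (sum-cong-≗ (λ s → sum-const k (r s * r s))) (sym (*-distribˡ-sum k (λ s → r s * r s)))

𝟙 : Bool → ℕ
𝟙 true  = 1
𝟙 false = 0

𝟙-∧ : ∀ a b → 𝟙 (a ∧ b) ≡ 𝟙 a * 𝟙 b
𝟙-∧ true  b = sym (+-identityʳ (𝟙 b))
𝟙-∧ false b = refl

∣p∣≡∑𝟙 : ∀ {n} (p : Subset n) → ∣ p ∣ ≡ ∑[ s < n ] 𝟙 (lookup p s)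
∣p∣≡∑𝟙 []          = refl
∣p∣≡∑𝟙 (true  ∷ p) = cong suc (∣p∣≡∑𝟙 p)
∣p∣≡∑𝟙 (false ∷ p) = ∣p∣≡∑𝟙 p

∣p∩q∣≡∑𝟙*𝟙 : ∀ {n} (p q : Subset n) →
             ∣ p ∩ q ∣ ≡ ∑[ s < n ] (𝟙 (lookup p s) * 𝟙 (lookup q s))
∣p∩q∣≡∑𝟙*𝟙 p q = trans (∣p∣≡∑𝟙 (p ∩ q))
  (sum-cong-≗ (λ s → trans (cong 𝟙 (lookup-zipWith _∧_ s p q)) (𝟙-∧ (lookup p s) (lookup q s))))

module _ {ℓ c} (B : Fin c → Subset ℓ) where

  degree : Fin ℓ → ℕ
  degree s = ∑[ i < c ] 𝟙 (lookup (B i) s)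

  ∑-degree≡∑-size : ∑[ s < ℓ ] degree s ≡ ∑[ i < c ] ∣ B i ∣
  ∑-degree≡∑-size = trans (∑-comm (λ s i → 𝟙 (lookup (B i) s)))
                          (sym (sum-cong-≗ (λ i → ∣p∣≡∑𝟙 (B i))))

  ∑-degree²≡∑∑-∣∩∣ : ∑[ s < ℓ ] (degree s * degree s) ≡ ∑[ i < c ] ∑[ j < c ] ∣ B i ∩ B j ∣
  ∑-degree²≡∑∑-∣∩∣ = begin
    ∑[ s < ℓ ] (degree s * degree s)              ≡⟨ sum-cong-≗ (λ s → sum*sum≡∑∑ (χ s) (χ s)) ⟩
    ∑[ s < ℓ ] ∑[ i < c ] ∑[ j < c ] (χ s i * χ s j) ≡⟨ ∑-comm (λ s i → ∑[ j < c ] (χ s i * χ s j)) ⟩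
    ∑[ i < c ] ∑[ s < ℓ ] ∑[ j < c ] (χ s i * χ s j) ≡⟨ sum-cong-≗ (λ i → ∑-comm (λ s j → χ s i * χ s j)) ⟩
    ∑[ i < c ] ∑[ j < c ] ∑[ s < ℓ ] (χ s i * χ s j) ≡⟨ sum-cong-≗ (λ i → sum-cong-≗ (λ j → ∣p∩q∣≡∑𝟙*𝟙 (B i) (B j))) ⟨
    ∑[ i < c ] ∑[ j < c ] ∣ B i ∩ B j ∣           ∎
    where
    open ≡-Reasoning
    χ : Fin ℓ → Fin c → ℕ
    χ s i = 𝟙 (lookup (B i) s)

  [∑∣Bᵢ∣]²≤ℓ*∑∑∣Bᵢ∩Bⱼ∣ : ∑[ i < c ] ∣ B i ∣ * ∑[ i < c ] ∣ B i ∣ ≤ ℓ * ∑[ i < c ] ∑[ j < c ] ∣ B i ∩ B j ∣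
  [∑∣Bᵢ∣]²≤ℓ*∑∑∣Bᵢ∩Bⱼ∣ = subst₂ _≤_ (cong₂ _*_ ∑-degree≡∑-size ∑-degree≡∑-size)
                                   (cong (ℓ *_) ∑-degree²≡∑∑-∣∩∣)
                                   (cauchy-schwarz degree)

module _ {ℓ c n} {card : Fin c → Subset ℓ} (D : IsDeck ℓ c n card) where
  open IsDeck D

  ∑-size≡c*n : ∑[ i < c ] ∣ card i ∣ ≡ c * n
  ∑-size≡c*n = trans (sum-cong-≗ D4) (sum-const c n)

module _ {ℓ c n} {card : Fin (suc c) → Subset ℓ} (D : IsDeck ℓ (suc c) n card) where
  open IsDeck D

  ∑-∣∩∣≡n+c : ∀ i → ∑[ j < suc c ] ∣ card i ∩ card j ∣ ≡ n + c
  ∑-∣∩∣≡n+c i = trans (sum-ones-except (λ j → ∣ card i ∩ card j ∣) i (λ j j≢i → D1 i j (≢-sym j≢i)))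
                      (cong (_+ c) (trans (cong ∣_∣ (∩-idem (card i))) (D4 i)))

  ∑∑-∣∩∣≡[1+c]*[n+c] : ∑[ i < suc c ] ∑[ j < suc c ] ∣ card i ∩ card j ∣ ≡ suc c * (n + c)
  ∑∑-∣∩∣≡[1+c]*[n+c] = trans (sum-cong-≗ ∑-∣∩∣≡n+c) (sum-const (suc c) (n + c))

mainTheorem3 : (ℓ c n : ℕ) (card : Fin c → Subset ℓ) → IsDeck ℓ c n card →
    c * n * n ≤ ℓ * (c + n ∸ 1)
mainTheorem3 ℓ zero    n card D = z≤n
mainTheorem3 ℓ (suc c) n card D = *-cancelˡ-≤ (suc c) (begin
  suc c * (suc c * n * n)                            ≡⟨ square (suc c) n ⟩
  (suc c * n) * (suc c * n)                          ≡⟨ cong₂ _*_ (∑-size≡c*n D) (∑-size≡c*n D) ⟨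
  ∑[ i < suc c ] ∣ card i ∣ * ∑[ i < suc c ] ∣ card i ∣ ≤⟨ [∑∣Bᵢ∣]²≤ℓ*∑∑∣Bᵢ∩Bⱼ∣ card ⟩
  ℓ * ∑[ i < suc c ] ∑[ j < suc c ] ∣ card i ∩ card j ∣ ≡⟨ cong (ℓ *_) (∑∑-∣∩∣≡[1+c]*[n+c] D) ⟩
  ℓ * (suc c * (n + c))                              ≡⟨ rearrange ℓ (suc c) n c ⟩
  suc c * (ℓ * (c + n))                              ∎)
  where
  open ≤-Reasoning
  square : ∀ k n → k * (k * n * n) ≡ (k * n) * (k * n)
  square = solve-∀
  rearrange : ∀ ℓ k n c → ℓ * (k * (n + c)) ≡ k * (ℓ * (c + n))
  rearrange = solve-∀
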